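{- For any finite simple connected graph $G$, if $\gamma_P(G)=1$, then $\gamma_P(G\Box P_2)\le 2$.
   Context: $P_2$ is the path on two vertices. The Cartesian product $G\Box H$ has vertex set $V(G)\times V(H)$, with $(g,h)$ adjacent to $(g',h')$ iff either $g=g'$ and $hh'\in E(H)$, or $h=h'$ and $gg'\in E(G)$. Zero forcing: for $U\subseteq V(G)$ (black vertices), repeatedly apply the rule "if a black vertex has exactly one white neighbor, that neighbor becomes black"; the resulting set is the closure $cl(U)$. A set $S$ is a power dominating set if $cl(N[S])=V(G)$, where $N[S]$ is the closed neighborhood of $S$; $\gamma_P(G)$ is the minimum cardinality of a power dominating set. -}

module Defs where

open import Data.Nat using (ℕ)
open import Data.Fin using (Fin)
open import Data.Product using (Σ; _×_; _,_; ∃)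
open import Data.Sum using (_⊎_; inj₁; inj₂)
open import Data.List using (List)
open import Data.List.Membership.Propositional using (_∈_)
open import Relation.Nullary using (¬_)
open import Relation.Binary.PropositionalEquality using (_≡_; _≢_; refl)
open import Relation.Binary.Construct.Closure.ReflexiveTransitive using (Star)

record Graph (V : Set) : Set₁ where
  field
    Adj    : V → V → Set
    sym    : ∀ {u v} → Adj u v → Adj v u
    irrefl : ∀ {u} → ¬ Adj u u
open Graph public

Connected : ∀ {V} → Graph V → Set
Connected G = ∀ u v → Star (Adj G) u v

P₂ : Graph (Fin 2)
P₂ = record
  { Adj = λ i j → i ≢ j
  ; sym = λ i≢j j≡i → i≢j (Relation.Binary.PropositionalEquality.sym j≡i)
  ; irrefl = λ i≢i → i≢i refl
  }

_□_ : ∀ {V W} → Graph V → Graph W → Graph (V × W)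
_□_ {V} {W} G H = record { Adj = A ; sym = sy ; irrefl = irr }
  where
  A : V × W → V × W → Set
  A (g , h) (g' , h') = (g ≡ g' × Adj H h h') ⊎ (h ≡ h' × Adj G g g')
  sy : ∀ {u v} → A u v → A v u
  sy (inj₁ (refl , a)) = inj₁ (refl , Graph.sym H a)
  sy (inj₂ (refl , a)) = inj₂ (refl , Graph.sym G a)
  irr : ∀ {u} → ¬ A u u
  irr (inj₁ (_ , a)) = Graph.irrefl H a
  irr (inj₂ (_ , a)) = Graph.irrefl G a

module _ {V : Set} (G : Graph V) where

  ClosedNbhd : List V → V → Set
  ClosedNbhd S v = ∃ λ u → u ∈ S × (u ≡ v ⊎ Adj G u v)

  data Cl (U : V → Set) : V → Set where
    base  : ∀ {v} → U v → Cl U v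
    force : ∀ {u v} → Cl U u → Adj G u v →
            (∀ w → Adj G u w → w ≢ v → Cl U w) → Cl U v

  IsPDS : List V → Set
  IsPDS S = ∀ v → Cl (ClosedNbhd S) v

open import Data.List using (length)
open import Data.List.Relation.Unary.Unique.Propositional using (Unique)
open import Data.Nat using (_≤_)

γP≡ : ∀ {V} → Graph V → ℕ → Set
γP≡ {V} G k =
  (∃ λ (S : List V) → Unique S × IsPDS G S × length S ≡ k) ×
  (∀ (S : List V) → Unique S → IsPDS G S → k ≤ length S)

γP≤ : ∀ {V} → Graph V → ℕ → Set
γP≤ {V} G k = ∃ λ (S : List V) → Unique S × IsPDS G S × length S ≤ k

-- A power dominating set S of G, copied onto every layer of G □ H, power
-- dominates G □ H: each forcing step u → v of G can be replayed in every
-- layer, since the only neighbours of (u , i) outside the layer G × {i} are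
-- the copies (u , j), which are black as soon as u is black in G.  For
-- H = P₂ and |S| = 1 this gives a power dominating set of size 2.
module Submission where

open import Defs
open import Data.Nat using (ℕ; s≤s; z≤n)
open import Data.Fin using (Fin; zero; suc)
open import Data.Product using (_×_; _,_)
open import Data.Sum using (inj₁; inj₂)
open import Data.List using (List; []; _∷_)
open import Data.List.Membership.Propositional using (_∈_)
open import Data.List.Relation.Unary.Any using (here; there)
open import Data.List.Relation.Unary.All using ([]; _∷_)
open import Data.List.Relation.Unary.AllPairs using ([]; _∷_)
open import Data.List.Relation.Unary.Unique.Propositional using (Unique)
open import Relation.Binary.PropositionalEquality using (refl; cong; _≢_)

module _ {V W : Set} (G : Graph V) (H : Graph W) where

  Cl-□-lift : {U : V → Set} {U′ : V × W → Set} →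
              (∀ {v} i → U v → U′ (v , i)) →
              ∀ {v} → Cl G U v → ∀ i → Cl (G □ H) U′ (v , i)
  Cl-□-lift U⊆U′ (base Uv) i = base (U⊆U′ i Uv)
  Cl-□-lift {U′ = U′} U⊆U′ {v} (force {u} Clu u~v rest) i =
    force (Cl-□-lift U⊆U′ Clu i) (inj₂ (refl , u~v)) restᵢ
    where
    restᵢ : ∀ w′ → Adj (G □ H) (u , i) w′ → w′ ≢ (v , i) → Cl (G □ H) U′ w′
    restᵢ (u , j) (inj₁ (refl , _))    _   = Cl-□-lift U⊆U′ Clu j
    restᵢ (w , i) (inj₂ (refl , u~w)) w≢v =
      Cl-□-lift U⊆U′ (rest w u~w (λ w≡v → w≢v (cong (_, i) w≡v))) i

  ClosedNbhd-□-lift : ∀ {S T} → (∀ {s} i → s ∈ S → (s , i) ∈ T) →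
                      ∀ {v} i → ClosedNbhd G S v → ClosedNbhd (G □ H) T (v , i)
  ClosedNbhd-□-lift S×W⊆T i (s , s∈S , inj₁ refl) = (s , i) , S×W⊆T i s∈S , inj₁ refl
  ClosedNbhd-□-lift S×W⊆T i (s , s∈S , inj₂ s~v) =
    (s , i) , S×W⊆T i s∈S , inj₂ (inj₂ (refl , s~v))

  IsPDS-□ : ∀ {S T} → (∀ {s} i → s ∈ S → (s , i) ∈ T) →
            IsPDS G S → IsPDS (G □ H) T
  IsPDS-□ S×W⊆T pds (v , i) =
    Cl-□-lift (ClosedNbhd-□-lift S×W⊆T) (pds v) i

module _ {V : Set} (s : V) where

  column : List (V × Fin 2)
  column = (s , zero) ∷ (s , suc zero) ∷ []

  column-unique : Unique column
  column-unique = ((λ ()) ∷ []) ∷ [] ∷ []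

  ∈-column : ∀ {t} i → t ∈ s ∷ [] → (t , i) ∈ column
  ∈-column zero       (here refl) = here refl
  ∈-column (suc zero) (here refl) = there (here refl)

mainTheorem13 : ∀ (n : ℕ) (G : Graph (Fin n)) → Connected G →
    γP≡ G 1 → γP≤ (G □ P₂) 2
mainTheorem13 n G _ ((s ∷ [] , _ , pds , refl) , _) =
  column s , column-unique s , IsPDS-□ G P₂ (∈-column s) pds , s≤s (s≤s z≤n)
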